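{- Let $T$ be one of $C_3,C_4,C_5,C_6,C_7,C_8,C_9,C_{10},C_{12},C_2\times C_4,C_2\times C_6,C_2\times C_8$, and let $a,b\in\mathbb{Q}$ be such that $E_T(-a,b)$ and $E_T(a,-b)$ are elliptic curves. Then $E_T(-a,b)$ is $\mathbb{Q}$-isomorphic to $E_T(a,-b)$.
   Context: For each $T$, $E_T(a,b)$ is the Weierstrass model $y^2+a_1xy+a_3y=x^3+a_2x^2$ with coefficients: $T=C_3$: $a_1=a$, $a_2=0$, $a_3=a^2b$. $T=C_4$: $a_1=a$, $a_2=-ab$, $a_3=-a^2b$. $T=C_5$: $a_1=a-b$, $a_2=-ab$, $a_3=-a^2b$. $T=C_6$: $a_1=a-b$, $a_2=-ab-b^2$, $a_3=-a^2b-ab^2$. $T=C_7$: $a_1=a^2+ab-b^2$, $a_2=a^2b^2-ab^3$, $a_3=a^4b^2-a^3b^3$. $T=C_8$: $a_1=-a^2+4ab-2b^2$, $a_2=-a^2b^2+3ab^3-2b^4$, $a_3=-a^3b^3+3a^2b^4-2ab^5$. $T=C_9$: $a_1=a^3+ab^2-b^3$, $a_2=a^4b^2-2a^3b^3+2a^2b^4-ab^5$, $a_3=a^3a_2$. $T=C_{10}$: $a_1=a^3-2a^2b-2ab^2+2b^3$, $a_2=-a^3b^3+3a^2b^4-2ab^5$, $a_3=(a^3-3a^2b+ab^2)a_2$. $T=C_{12}$: $a_1=-a^4+2a^3b+2a^2b^2-8ab^3+6b^4$, $a_2=b(a-2b)(a-b)^2(a^2-3ab+3b^2)(a^2-2ab+2b^2)$,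 $a_3=a(b-a)^3a_2$. $T=C_2\times C_4$: $a_1=a$, $a_2=-ab-4b^2$, $a_3=-a^2b-4ab^2$. $T=C_2\times C_6$: $a_1=-19a^2+2ab+b^2$, $a_2=-10a^4+22a^3b-14a^2b^2+2ab^3$, $a_3=90a^6-198a^5b+116a^4b^2+4a^3b^3-14a^2b^4+2ab^5$. $T=C_2\times C_8$: $a_1=-a^4-8a^3b-24a^2b^2+64b^4$, $a_2=-4ab^2(a+2b)(a+4b)^2(a^2+4ab+8b^2)$, $a_3=-2b(a+4b)(a^2-8b^2)a_2$. -}

module Defs where

open import Data.Nat using (ℕ; zero; suc)
open import Data.Integer using (+_)
open import Data.Rational using (ℚ; _/_; _+_; _*_; _-_; -_; 0ℚ; 1ℚ)
open import Relation.Binary.PropositionalEquality using (_≡_)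
open import Relation.Nullary using (¬_)
open import Data.Product using (Σ; ∃; _×_)

nat : ℕ → ℚ
nat n = + n / 1

infixr 8 _^_
_^_ : ℚ → ℕ → ℚ
x ^ zero = 1ℚ
x ^ suc n = x * (x ^ n)

-- general Weierstrass model y^2 + a1 xy + a3 y = x^3 + a2 x^2 + a4 x + a6 over ℚ
record Weierstrass : Set where
  constructor mkW
  field
    a₁ a₂ a₃ a₄ a₆ : ℚ

open Weierstrass public

-- standard discriminant (Silverman III.1)
disc : Weierstrass → ℚ
disc E = - (b₂ * b₂ * b₈) - nat 8 * b₄ ^ 3 - nat 27 * b₆ * b₆ + nat 9 * b₂ * b₄ * b₆
  where
  b₂ = a₁ E * a₁ E + nat 4 * a₂ E
  b₄ = nat 2 * a₄ E + a₁ E * a₃ E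
  b₆ = a₃ E * a₃ E + nat 4 * a₆ E
  b₈ = a₁ E * a₁ E * a₆ E + nat 4 * a₂ E * a₆ E - a₁ E * a₃ E * a₄ E
       + a₂ E * a₃ E * a₃ E - a₄ E * a₄ E

IsElliptic : Weierstrass → Set
IsElliptic E = ¬ (disc E ≡ 0ℚ)

-- E' is obtained from E by the change of variables
-- x = u^2 x' + r, y = u^3 y' + s u^2 x' + t  (Silverman III.1, Table 3.1)
IsChangeOfVars : Weierstrass → Weierstrass → ℚ → ℚ → ℚ → ℚ → Set
IsChangeOfVars E E' u r s t =
    (u * a₁ E' ≡ a₁ E + nat 2 * s)
  × (u ^ 2 * a₂ E' ≡ a₂ E - s * a₁ E + nat 3 * r - s * s)
  × (u ^ 3 * a₃ E' ≡ a₃ E + r * a₁ E + nat 2 * t)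
  × (u ^ 4 * a₄ E' ≡ a₄ E - s * a₃ E + nat 2 * r * a₂ E - (t + r * s) * a₁ E
                     + nat 3 * r * r - nat 2 * s * t)
  × (u ^ 6 * a₆ E' ≡ a₆ E + r * a₄ E + r * r * a₂ E + r ^ 3 - t * a₃ E - t * t
                     - r * t * a₁ E)

QIsomorphic : Weierstrass → Weierstrass → Set
QIsomorphic E E' = Σ ℚ λ u → ¬ (u ≡ 0ℚ) × ∃ λ r → ∃ λ s → ∃ λ t → IsChangeOfVars E E' u r s t

data Torsion : Set where
  C3 C4 C5 C6 C7 C8 C9 C10 C12 C2×C4 C2×C6 C2×C8 : Torsion

model : ℚ → ℚ → ℚ → Weierstrass
model x₁ x₂ x₃ = mkW x₁ x₂ x₃ 0ℚ 0ℚ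

E : Torsion → ℚ → ℚ → Weierstrass
E C3 a b = model a 0ℚ (a ^ 2 * b)
E C4 a b = model a (- (a * b)) (- (a ^ 2 * b))
E C5 a b = model (a - b) (- (a * b)) (- (a ^ 2 * b))
E C6 a b = model (a - b) (- (a * b) - b ^ 2) (- (a ^ 2 * b) - a * b ^ 2)
E C7 a b = model (a ^ 2 + a * b - b ^ 2) (a ^ 2 * b ^ 2 - a * b ^ 3)
                 (a ^ 4 * b ^ 2 - a ^ 3 * b ^ 3)
E C8 a b = model (- (a ^ 2) + nat 4 * a * b - nat 2 * b ^ 2)
                 (- (a ^ 2 * b ^ 2) + nat 3 * a * b ^ 3 - nat 2 * b ^ 4)
                 (- (a ^ 3 * b ^ 3) + nat 3 * a ^ 2 * b ^ 4 - nat 2 * a * b ^ 5)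
E C9 a b = model (a ^ 3 + a * b ^ 2 - b ^ 3) A₂ (a ^ 3 * A₂)
  where A₂ = a ^ 4 * b ^ 2 - nat 2 * a ^ 3 * b ^ 3 + nat 2 * a ^ 2 * b ^ 4 - a * b ^ 5
E C10 a b = model (a ^ 3 - nat 2 * a ^ 2 * b - nat 2 * a * b ^ 2 + nat 2 * b ^ 3) A₂
                  ((a ^ 3 - nat 3 * a ^ 2 * b + a * b ^ 2) * A₂)
  where A₂ = - (a ^ 3 * b ^ 3) + nat 3 * a ^ 2 * b ^ 4 - nat 2 * a * b ^ 5
E C12 a b = model (- (a ^ 4) + nat 2 * a ^ 3 * b + nat 2 * a ^ 2 * b ^ 2
                   - nat 8 * a * b ^ 3 + nat 6 * b ^ 4) A₂ (a * (b - a) ^ 3 * A₂)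
  where A₂ = b * (a - nat 2 * b) * (a - b) ^ 2 * (a ^ 2 - nat 3 * a * b + nat 3 * b ^ 2)
             * (a ^ 2 - nat 2 * a * b + nat 2 * b ^ 2)
E C2×C4 a b = model a (- (a * b) - nat 4 * b ^ 2) (- (a ^ 2 * b) - nat 4 * a * b ^ 2)
E C2×C6 a b = model (- (nat 19 * a ^ 2) + nat 2 * a * b + b ^ 2)
                    (- (nat 10 * a ^ 4) + nat 22 * a ^ 3 * b - nat 14 * a ^ 2 * b ^ 2
                     + nat 2 * a * b ^ 3)
                    (nat 90 * a ^ 6 - nat 198 * a ^ 5 * b + nat 116 * a ^ 4 * b ^ 2
                     + nat 4 * a ^ 3 * b ^ 3 - nat 14 * a ^ 2 * b ^ 4 + nat 2 * a * b ^ 5)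
E C2×C8 a b = model (- (a ^ 4) - nat 8 * a ^ 3 * b - nat 24 * a ^ 2 * b ^ 2 + nat 64 * b ^ 4)
                    A₂ (- (nat 2 * b * (a + nat 4 * b) * (a ^ 2 - nat 8 * b ^ 2)) * A₂)
  where A₂ = - (nat 4 * a * b ^ 2 * (a + nat 2 * b) * (a + nat 4 * b) ^ 2
                * (a ^ 2 + nat 4 * a * b + nat 8 * b ^ 2))

module Submission where

-- Every model E_T(a,b) is weighted homogeneous: there is a weight w
-- (1, 2, 3 or 4 depending on T) such that the coefficient a_i is a homogeneous
-- polynomial of degree i·w in (a,b).  Since (a,-b) = -(-a,b), this gives
--   a_i(a,-b) = (-1)^(i·w) · a_i(-a,b),
-- i.e. E_T(a,-b) arises from E_T(-a,b) by the scaling x ↦ u²x, y ↦ u³y with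
-- u = (-1)^w; for even w the two models even coincide.  No hypothesis on the
-- discriminant is needed.

open import Defs
open import Data.Rational using (ℚ; -_; _+_; _*_; _-_; 0ℚ; 1ℚ)
open import Data.Rational.Properties
  using (+-0-group; neg-distrib-+; neg-distribˡ-*; neg-distribʳ-*; +-identityʳ;
         *-identityˡ; *-identityʳ; *-zeroˡ; *-zeroʳ)
open import Algebra.Properties.Group +-0-group using (⁻¹-involutive)
open import Data.Nat using (ℕ; zero; suc)
open import Data.Bool using (Bool; true; false; not; _∧_; _xor_)
open import Data.Bool.Properties using (xor-same)
open import Data.Product using (_,_)
open import Relation.Nullary using (¬_)
open import Relation.Binary.PropositionalEquality
open ≡-Reasoning

odd : ℕ → Bool
odd zero = false
odd (suc n) = not (odd n)

signed : Bool → ℚ → ℚ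
signed true x = - x
signed false x = x

neg-involutive : ∀ x → - (- x) ≡ x
neg-involutive = ⁻¹-involutive

signed-neg : ∀ p x → - signed p x ≡ signed p (- x)
signed-neg true x = refl
signed-neg false x = refl

signed-+ : ∀ p x y → signed p x + signed p y ≡ signed p (x + y)
signed-+ true x y = sym (neg-distrib-+ x y)
signed-+ false x y = refl

signed-- : ∀ p x y → signed p x - signed p y ≡ signed p (x - y)
signed-- p x y = trans (cong (signed p x +_) (signed-neg p y)) (signed-+ p x (- y))

signed-* : ∀ p q x y → signed p x * signed q y ≡ signed (p xor q) (x * y)
signed-* false false x y = refl
signed-* false true x y = sym (neg-distribʳ-* x y)
signed-* true false x y = sym (neg-distribˡ-* x y)
signed-* true true x y = begin
  - x * - y       ≡⟨ neg-distribˡ-* x (- y) ⟨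
  - (x * - y)     ≡⟨ cong -_ (neg-distribʳ-* x y) ⟨
  - (- (x * y))   ≡⟨ neg-involutive (x * y) ⟩
  x * y           ∎

signed-^ : ∀ p x n → signed p x ^ n ≡ signed (p ∧ odd n) (x ^ n)
signed-^ false x n = refl
signed-^ true x zero = refl
signed-^ true x (suc n) =
  trans (cong (- x *_) (signed-^ true x n)) (signed-* true (odd n) x (x ^ n))

1^n≡1 : ∀ n → 1ℚ ^ n ≡ 1ℚ
1^n≡1 zero = refl
1^n≡1 (suc n) = trans (*-identityˡ (1ℚ ^ n)) (1^n≡1 n)

-- The unit u = (-1)^p undoes the sign of a quantity of weight n:
-- uⁿ · (-1)^(p·n) x = x.  This is what makes u a valid scaling factor.
unit-cancels : ∀ p n x → signed p 1ℚ ^ n * signed (p ∧ odd n) x ≡ x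
unit-cancels p n x = begin
  signed p 1ℚ ^ n * signed q x      ≡⟨ cong (_* signed q x) (signed-^ p 1ℚ n) ⟩
  signed q (1ℚ ^ n) * signed q x    ≡⟨ cong (λ t → signed q t * signed q x) (1^n≡1 n) ⟩
  signed q 1ℚ * signed q x          ≡⟨ signed-* q q 1ℚ x ⟩
  signed (q xor q) (1ℚ * x)         ≡⟨ cong (λ r → signed r (1ℚ * x)) (xor-same q) ⟩
  1ℚ * x                            ≡⟨ *-identityˡ x ⟩
  x                                 ∎
  where q = p ∧ odd n

unit-nonzero : ∀ p → ¬ (signed p 1ℚ ≡ 0ℚ)
unit-nonzero true ()
unit-nonzero false ()

-- Polynomial expressions in two variables X, Y with natural constants, indexed
-- by the parity of their degree; a sum only combines terms of equal parity, so
-- every expression is homogeneous modulo 2.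
infixl 6 _:+_ _:-_
infixl 7 _:*_
infixr 8 _:^_

data Poly : Bool → Set where
  X Y   : Poly true
  #_    : ℕ → Poly false
  _:+_  : ∀ {p} → Poly p → Poly p → Poly p
  _:-_  : ∀ {p} → Poly p → Poly p → Poly p
  :-_   : ∀ {p} → Poly p → Poly p
  _:*_  : ∀ {p q} → Poly p → Poly q → Poly (p xor q)
  _:^_  : ∀ {p} → Poly p → (n : ℕ) → Poly (p ∧ odd n)

⟦_⟧ : ∀ {p} → Poly p → ℚ → ℚ → ℚ
⟦ X ⟧ x y = x
⟦ Y ⟧ x y = y
⟦ # n ⟧ x y = nat n
⟦ c :+ d ⟧ x y = ⟦ c ⟧ x y + ⟦ d ⟧ x y
⟦ c :- d ⟧ x y = ⟦ c ⟧ x y - ⟦ d ⟧ x y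
⟦ :- c ⟧ x y = - ⟦ c ⟧ x y
⟦ c :* d ⟧ x y = ⟦ c ⟧ x y * ⟦ d ⟧ x y
⟦ c :^ n ⟧ x y = ⟦ c ⟧ x y ^ n

eval-neg : ∀ {p} (c : Poly p) x y → ⟦ c ⟧ (- x) (- y) ≡ signed p (⟦ c ⟧ x y)
eval-neg X x y = refl
eval-neg Y x y = refl
eval-neg (# n) x y = refl
eval-neg {p} (c :+ d) x y =
  trans (cong₂ _+_ (eval-neg c x y) (eval-neg d x y)) (signed-+ p _ _)
eval-neg {p} (c :- d) x y =
  trans (cong₂ _-_ (eval-neg c x y) (eval-neg d x y)) (signed-- p _ _)
eval-neg {p} (:- c) x y = trans (cong -_ (eval-neg c x y)) (signed-neg p _)
eval-neg (_:*_ {p} {q} c d) x y =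
  trans (cong₂ _*_ (eval-neg c x y) (eval-neg d x y)) (signed-* p q _ _)
eval-neg (_:^_ {p} c n) x y =
  trans (cong (_^ n) (eval-neg c x y)) (signed-^ p _ n)

-- The form used for the theorem, since (a,-b) = -(-a,b).
eval-flip : ∀ {p} (c : Poly p) a b → ⟦ c ⟧ a (- b) ≡ signed p (⟦ c ⟧ (- a) b)
eval-flip {p} c a b = begin
  ⟦ c ⟧ a (- b)            ≡⟨ cong (λ x → ⟦ c ⟧ x (- b)) (neg-involutive a) ⟨
  ⟦ c ⟧ (- (- a)) (- b)    ≡⟨ eval-neg c (- a) b ⟩
  signed p (⟦ c ⟧ (- a) b) ∎

-- A pure scaling x = u²x', y = u³y' (r = s = t = 0) is an isomorphism between
-- models y²+a₁xy+a₃y = x³+a₂x² as soon as uⁱ a′ᵢ = aᵢ for i = 1, 2, 3; the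
-- remaining conditions of the change of variables only involve vanishing terms.
scaling-iso : ∀ {a₁ a₂ a₃ a₁′ a₂′ a₃′} (u : ℚ) → ¬ (u ≡ 0ℚ) →
  u * a₁′ ≡ a₁ → u ^ 2 * a₂′ ≡ a₂ → u ^ 3 * a₃′ ≡ a₃ →
  QIsomorphic (model a₁ a₂ a₃) (model a₁′ a₂′ a₃′)
scaling-iso {a₁} {a₂} {a₃} {a₁′} {a₂′} {a₃′} u u≢0 e₁ e₂ e₃ =
  u , u≢0 , 0ℚ , 0ℚ , 0ℚ , coeff₁ , coeff₂ , coeff₃ , coeff₄ , coeff₆
  where
  coeff₁ : u * a₁′ ≡ a₁ + nat 2 * 0ℚ
  coeff₁ = trans e₁ (sym (+-identityʳ a₁))
  coeff₂ : u ^ 2 * a₂′ ≡ a₂ - 0ℚ * a₁ + nat 3 * 0ℚ - 0ℚ * 0ℚ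
  coeff₂ rewrite *-zeroˡ a₁ | +-identityʳ a₂ | +-identityʳ a₂ | +-identityʳ a₂ = e₂
  coeff₃ : u ^ 3 * a₃′ ≡ a₃ + 0ℚ * a₁ + nat 2 * 0ℚ
  coeff₃ rewrite *-zeroˡ a₁ | +-identityʳ a₃ | +-identityʳ a₃ = e₃
  coeff₄ : u ^ 4 * 0ℚ ≡ 0ℚ - 0ℚ * a₃ + nat 2 * 0ℚ * a₂ - (0ℚ + 0ℚ * 0ℚ) * a₁
                       + nat 3 * 0ℚ * 0ℚ - nat 2 * 0ℚ * 0ℚ
  coeff₄ rewrite *-zeroʳ (u ^ 4) | *-zeroˡ a₃ | *-zeroˡ a₂ | *-zeroˡ a₁ = refl
  coeff₆ : u ^ 6 * 0ℚ ≡ 0ℚ + 0ℚ * 0ℚ + 0ℚ * 0ℚ * a₂ + 0ℚ ^ 3 - 0ℚ * a₃ - 0ℚ * 0ℚ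
                       - 0ℚ * 0ℚ * a₁
  coeff₆ rewrite *-zeroʳ (u ^ 6) | *-zeroˡ a₃ | *-zeroˡ a₂ | *-zeroˡ a₁ = refl

graded-model : ∀ {p q r} → Poly p → Poly q → Poly r → ℚ → ℚ → Weierstrass
graded-model c₁ c₂ c₃ x y = model (⟦ c₁ ⟧ x y) (⟦ c₂ ⟧ x y) (⟦ c₃ ⟧ x y)

graded-iso : ∀ p (c₁ : Poly (p ∧ odd 1)) (c₂ : Poly (p ∧ odd 2)) (c₃ : Poly (p ∧ odd 3))
  (a b : ℚ) → QIsomorphic (graded-model c₁ c₂ c₃ (- a) b) (graded-model c₁ c₂ c₃ a (- b))
graded-iso p c₁ c₂ c₃ a b =
  scaling-iso u (unit-nonzero p) rescaled₁ (rescaled 2 c₂) (rescaled 3 c₃)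
  where
  u : ℚ
  u = signed p 1ℚ
  rescaled : ∀ n (c : Poly (p ∧ odd n)) → u ^ n * ⟦ c ⟧ a (- b) ≡ ⟦ c ⟧ (- a) b
  rescaled n c = trans (cong (u ^ n *_) (eval-flip c a b)) (unit-cancels p n _)
  -- u¹ = u * 1 is only propositionally equal to u.
  rescaled₁ : u * ⟦ c₁ ⟧ a (- b) ≡ ⟦ c₁ ⟧ (- a) b
  rescaled₁ = trans (cong (_* ⟦ c₁ ⟧ a (- b)) (sym (*-identityʳ u))) (rescaled 1 c₁)

-- Lemma 4.2: the coefficients of E_T have odd weight 1 (C₃, C₄, C₅, C₆, C₂×C₄)
-- or 3 (C₉, C₁₀), and even weight 2 (C₇, C₈, C₂×C₆) or 4 (C₁₂, C₂×C₈).
lemma4p2 : (T : Torsion) (a b : ℚ) →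
    IsElliptic (E T (- a) b) → IsElliptic (E T a (- b)) →
    QIsomorphic (E T (- a) b) (E T a (- b))
lemma4p2 C3 a b _ _ = graded-iso true X (# 0) (X :^ 2 :* Y) a b
lemma4p2 C4 a b _ _ = graded-iso true X (:- (X :* Y)) (:- (X :^ 2 :* Y)) a b
lemma4p2 C5 a b _ _ = graded-iso true (X :- Y) (:- (X :* Y)) (:- (X :^ 2 :* Y)) a b
lemma4p2 C6 a b _ _ =
  graded-iso true (X :- Y) (:- (X :* Y) :- Y :^ 2) (:- (X :^ 2 :* Y) :- X :* Y :^ 2) a b
lemma4p2 C7 a b _ _ =
  graded-iso false (X :^ 2 :+ X :* Y :- Y :^ 2) (X :^ 2 :* Y :^ 2 :- X :* Y :^ 3)
                   (X :^ 4 :* Y :^ 2 :- X :^ 3 :* Y :^ 3) a b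
lemma4p2 C8 a b _ _ =
  graded-iso false (:- (X :^ 2) :+ # 4 :* X :* Y :- # 2 :* Y :^ 2)
                   (:- (X :^ 2 :* Y :^ 2) :+ # 3 :* X :* Y :^ 3 :- # 2 :* Y :^ 4)
                   (:- (X :^ 3 :* Y :^ 3) :+ # 3 :* X :^ 2 :* Y :^ 4 :- # 2 :* X :* Y :^ 5) a b
lemma4p2 C9 a b _ _ = graded-iso true (X :^ 3 :+ X :* Y :^ 2 :- Y :^ 3) A₂ (X :^ 3 :* A₂) a b
  where A₂ = X :^ 4 :* Y :^ 2 :- # 2 :* X :^ 3 :* Y :^ 3 :+ # 2 :* X :^ 2 :* Y :^ 4 :- X :* Y :^ 5
lemma4p2 C10 a b _ _ =
  graded-iso true (X :^ 3 :- # 2 :* X :^ 2 :* Y :- # 2 :* X :* Y :^ 2 :+ # 2 :* Y :^ 3) A₂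
                  ((X :^ 3 :- # 3 :* X :^ 2 :* Y :+ X :* Y :^ 2) :* A₂) a b
  where A₂ = :- (X :^ 3 :* Y :^ 3) :+ # 3 :* X :^ 2 :* Y :^ 4 :- # 2 :* X :* Y :^ 5
lemma4p2 C12 a b _ _ =
  graded-iso false (:- (X :^ 4) :+ # 2 :* X :^ 3 :* Y :+ # 2 :* X :^ 2 :* Y :^ 2
                    :- # 8 :* X :* Y :^ 3 :+ # 6 :* Y :^ 4) A₂ (X :* (Y :- X) :^ 3 :* A₂) a b
  where A₂ = Y :* (X :- # 2 :* Y) :* (X :- Y) :^ 2 :* (X :^ 2 :- # 3 :* X :* Y :+ # 3 :* Y :^ 2)
             :* (X :^ 2 :- # 2 :* X :* Y :+ # 2 :* Y :^ 2)
lemma4p2 C2×C4 a b _ _ =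
  graded-iso true X (:- (X :* Y) :- # 4 :* Y :^ 2) (:- (X :^ 2 :* Y) :- # 4 :* X :* Y :^ 2) a b
lemma4p2 C2×C6 a b _ _ =
  graded-iso false (:- (# 19 :* X :^ 2) :+ # 2 :* X :* Y :+ Y :^ 2)
                   (:- (# 10 :* X :^ 4) :+ # 22 :* X :^ 3 :* Y :- # 14 :* X :^ 2 :* Y :^ 2
                    :+ # 2 :* X :* Y :^ 3)
                   (# 90 :* X :^ 6 :- # 198 :* X :^ 5 :* Y :+ # 116 :* X :^ 4 :* Y :^ 2
                    :+ # 4 :* X :^ 3 :* Y :^ 3 :- # 14 :* X :^ 2 :* Y :^ 4 :+ # 2 :* X :* Y :^ 5) a b
lemma4p2 C2×C8 a b _ _ =
  graded-iso false (:- (X :^ 4) :- # 8 :* X :^ 3 :* Y :- # 24 :* X :^ 2 :* Y :^ 2 :+ # 64 :* Y :^ 4)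
                   A₂ (:- (# 2 :* Y :* (X :+ # 4 :* Y) :* (X :^ 2 :- # 8 :* Y :^ 2)) :* A₂) a b
  where A₂ = :- (# 4 :* X :* Y :^ 2 :* (X :+ # 2 :* Y) :* (X :+ # 4 :* Y) :^ 2
                 :* (X :^ 2 :+ # 4 :* X :* Y :+ # 8 :* Y :^ 2))
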